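{- Let $k, m, n$ be positive integers. The number of primitive arrays of dimension $m \times n$ over a $k$-letter alphabet equals $$\psi_k(m,n) = \sum_{d_1 \mid m}\ \sum_{d_2 \mid n} \mu(d_1)\mu(d_2)\, k^{mn/(d_1 d_2)},$$ where $\mu$ is the Möbius function.
   Context: For an $m\times n$ array $A$ over an alphabet and positive integers $p,q$, $A^{p\times q}$ is the $pm \times qn$ array $B$ with $B[i,j] = A[i \bmod m, j \bmod n]$ (indices from $0$). A nonempty array $M$ is primitive if whenever $M = A^{p\times q}$ for some array $A$ and positive integers $p,q$, we have $p = q = 1$. The Möbius function is $\mu(n) = (-1)^t$ if $n$ is squarefree with $t$ distinct prime factors, and $\mu(n)=0$ otherwise. -}

module Defs where

open import Data.Nat using (ℕ; zero; suc; _+_; _*_; _^_; _≤_; _<_; NonZero)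
open import Data.Nat.DivMod using (_/_; _mod_)
open import Data.Nat.Divisibility using (_∣_; _∣?_)
open import Data.Nat.Primality using (prime?)
open import Data.Fin using (Fin; toℕ)
open import Data.Vec using (Vec; lookup)
open import Data.List using (List; []; _∷_; length; filter; applyUpTo; map; foldr)
open import Data.List.Relation.Unary.Unique.Propositional using (Unique)
open import Data.List.Membership.Propositional using (_∈_)
open import Data.Integer as ℤ using (ℤ; +_; -_)
open import Data.Product using (Σ; _×_)
open import Relation.Binary.PropositionalEquality using (_≡_)
open import Relation.Nullary using (¬_)
open import Function.Bundles using (_⇔_)

Array : ℕ → ℕ → ℕ → Set
Array k m n = Vec (Vec (Fin k) n) m

entry : ∀ {k m n} → Array k m n → Fin m → Fin n → Fin k
entry M i j = lookup (lookup M i) j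

IsPower : ∀ {k m n a b} .{{_ : NonZero a}} .{{_ : NonZero b}} →
          Array k m n → Array k a b → ℕ → ℕ → Set
IsPower {m = m} {n} {a} {b} M A p q =
  (p * a ≡ m) × (q * b ≡ n) ×
  (∀ (i : Fin m) (j : Fin n) → entry M i j ≡ entry A (toℕ i mod a) (toℕ j mod b))

-- Primitive: whenever M = A^{p×q} with p, q positive, then p = q = 1.
-- (A is necessarily nonempty since M is; m, n > 0 in the theorem.)
Primitive : ∀ {k m n} → Array k m n → Set
Primitive {k} M =
  ∀ (a b : ℕ) .{{_ : NonZero a}} .{{_ : NonZero b}} (A : Array k a b) (p q : ℕ) →
  1 ≤ p → 1 ≤ q → IsPower M A p q → (p ≡ 1) × (q ≡ 1)

NumberOfPrimitiveArrays≡ : ℕ → ℕ → ℕ → ℤ → Set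
NumberOfPrimitiveArrays≡ k m n N =
  Σ (List (Array k m n)) λ xs →
    Unique xs × (∀ M → (M ∈ xs) ⇔ Primitive M) × (+ length xs ≡ N)

divisors : ℕ → List ℕ
divisors n = filter (_∣? n) (applyUpTo suc n)

-- squarefree: no d ≥ 2 with d² ∣ n (d ranges over 2..n, which suffices for n ≥ 1)
squarefreeCheck : ℕ → List ℕ
squarefreeCheck n = filter (λ d → d * d ∣? n) (applyUpTo (λ i → suc (suc i)) n)

primeFactors : ℕ → List ℕ
primeFactors n = filter prime? (divisors n)

signPow : ℕ → ℤ
signPow zero = + 1
signPow (suc t) = - signPow t

μ : ℕ → ℤ
μ n with squarefreeCheck n
... | [] = signPow (length (primeFactors n))
... | _ ∷ _ = + 0

-- exact division helper (the divisor is always a positive divisor here)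
_div'_ : ℕ → ℕ → ℕ
a div' zero = 0
a div' suc b = a / suc b

sumℤ : List ℤ → ℤ
sumℤ = foldr ℤ._+_ (+ 0)

ψ : ℕ → ℕ → ℕ → ℤ
ψ k m n =
  sumℤ (map (λ d₁ →
    sumℤ (map (λ d₂ →
      (μ d₁ ℤ.* μ d₂) ℤ.* + (k ^ ((m * n) div' (d₁ * d₂))))
      (divisors n)))
    (divisors m))

module Submission where

-- Extend an m × n array M periodically to ℕ × ℕ.  Its row periods form a
-- set containing m and closed under gcd (Bézout) and multiples, so they are the
-- multiples of a least row period; likewise for columns.  M is primitive exactly
-- when its least row period is m and its least column period is n.  For a ∣ m,
-- b ∣ n the arrays with row period a and column period b are the repetitions of
-- the a × b arrays, so there are k^{ab} of them.  Möbius inversion over the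
-- divisors of m (resp. n) turns the period indicators into the indicator of
-- "least period = m" (resp. n); summing over all arrays and exchanging the
-- finite sums gives ψ_k(m,n) = number of primitive arrays.

open import Defs
import Algebra.Properties.CommutativeSemigroup as SemigroupProperties
open import Data.Empty using (⊥-elim)
open import Data.Fin as Fin using (Fin; toℕ)
import Data.Fin.Properties as FinP
open import Data.Integer using (ℤ; +_; -_) renaming (_+_ to _+ℤ_; _*_ to _*ℤ_)
import Data.Integer.Properties as ℤP
open import Data.List using (List; []; _∷_; map; filter; length; applyUpTo; cartesianProductWith; allFin)
open import Data.List.Properties using (length-map; length-++; length-tabulate)
open import Data.List.Membership.Propositional using (_∈_)
open import Data.List.Membership.Propositional.Properties
  using (∈-filter⁺; ∈-filter⁻; ∈-applyUpTo⁺; ∈-applyUpTo⁻; ∈-map⁺; ∈-map⁻; ∈-cartesianProductWith⁺; ∈-allFin)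
open import Data.List.Membership.Propositional.Properties.WithK using (unique∧set⇒bag)
open import Data.List.Relation.Binary.BagAndSetEquality using (∼bag⇒↭)
open import Data.List.Relation.Binary.Permutation.Propositional as Perm using (_↭_)
open import Data.List.Relation.Binary.Permutation.Propositional.Properties using (↭-length)
open import Data.List.Relation.Unary.All as All using (All; []; _∷_)
open import Data.List.Relation.Unary.AllPairs using ([]; _∷_)
open import Data.List.Relation.Unary.Any using (here; there)
open import Data.List.Relation.Unary.Unique.Propositional using (Unique)
import Data.List.Relation.Unary.Unique.Propositional.Properties as Unique
open import Data.Nat as ℕ using (ℕ; zero; suc; NonZero; _≤_; _<_; z≤n; s≤s; _*_; _+_; _/_; _%_; _^_)
import Data.Nat.Properties as ℕP
open import Data.Nat.Coprimality using (Coprime; coprime-divisor)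
open import Data.Nat.Divisibility
open import Data.Nat.DivMod
  using (_mod_; m*n/n≡m; m≡m%n+[m/n]*n; m%n<n; m<n⇒m%n≡m; m%n%n≡m%n; [m+n]%n≡m%n; m∣n⇒o%n%m≡o%m)
open import Data.Nat.GCD using (gcd; gcd-GCD; gcd[m,n]∣m; gcd[m,n]∣n; gcd[m,n]≢0; module Bézout)
open import Data.Nat.ListAction using (product)
open import Data.Nat.Primality
  using (Prime; prime?; euclidsLemma; prime⇒irreducible; prime⇒nonZero; prime⇒nonTrivial; ¬prime[1])
open import Data.Nat.Primality.Factorisation using (factorise; PrimeFactorisation)
open import Data.Product using (_×_; _,_; proj₁; proj₂; ∃)
open import Data.Sum using (_⊎_; inj₁; inj₂)
open import Data.Vec as Vec using (Vec; lookup; tabulate)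
import Data.Vec.Properties as VecP
open import Function using (case_of_)
open import Function.Bundles using (_⇔_; mk⇔; Equivalence)
open import Relation.Binary.PropositionalEquality
open import Relation.Nullary using (Dec; yes; no; ¬_; ¬?; contradiction)
open import Relation.Nullary.Decidable using (_×-dec_; map′)
open import Relation.Unary using (Decidable)

open SemigroupProperties ℕP.+-commutativeSemigroup using () renaming (xy∙z≈xz∙y to +-right-comm)
open SemigroupProperties ℕP.*-commutativeSemigroup using ()
  renaming (xy∙z≈xz∙y to *-right-comm; interchange to *-interchange)
open SemigroupProperties ℤP.+-commutativeSemigroup using ()
  renaming (x∙yz≈y∙xz to +ℤ-left-comm; interchange to +ℤ-interchange)
open SemigroupProperties ℤP.*-commutativeSemigroup using () renaming (interchange to *ℤ-interchange)

∑ : {A : Set} → (A → ℤ) → List A → ℤ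
∑ f xs = sumℤ (map f xs)

same-members⇒↭ : {A : Set} {xs ys : List A} → Unique xs → Unique ys →
                 (∀ z → (z ∈ xs) ⇔ (z ∈ ys)) → xs ↭ ys
same-members⇒↭ uxs uys same = ∼bag⇒↭ (unique∧set⇒bag uxs uys (λ {z} → same z))

∑-cong : {A : Set} {f g : A → ℤ} (xs : List A) →
         (∀ x → x ∈ xs → f x ≡ g x) → ∑ f xs ≡ ∑ g xs
∑-cong []       f≡g = refl
∑-cong (x ∷ xs) f≡g = cong₂ _+ℤ_ (f≡g x (here refl)) (∑-cong xs (λ y y∈ → f≡g y (there y∈)))

∑-↭ : {A : Set} (f : A → ℤ) {xs ys : List A} → xs ↭ ys → ∑ f xs ≡ ∑ f ys
∑-↭ f Perm.refl                   = refl
∑-↭ f (Perm.prep x p)             = cong (f x +ℤ_) (∑-↭ f p)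
∑-↭ f (Perm.swap {ys = ys} x y p) =
  trans (cong (λ s → f x +ℤ (f y +ℤ s)) (∑-↭ f p)) (+ℤ-left-comm (f x) (f y) (∑ f ys))
∑-↭ f (Perm.trans p q)            = trans (∑-↭ f p) (∑-↭ f q)

∑-zero : {A : Set} (xs : List A) → ∑ (λ _ → + 0) xs ≡ + 0
∑-zero []       = refl
∑-zero (x ∷ xs) = trans (ℤP.+-identityˡ _) (∑-zero xs)

∑-+ : {A : Set} (f g : A → ℤ) (xs : List A) → ∑ (λ x → f x +ℤ g x) xs ≡ ∑ f xs +ℤ ∑ g xs
∑-+ f g []       = refl
∑-+ f g (x ∷ xs) = trans (cong ((f x +ℤ g x) +ℤ_) (∑-+ f g xs)) (+ℤ-interchange (f x) (g x) (∑ f xs) (∑ g xs))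

∑-neg : {A : Set} (f : A → ℤ) (xs : List A) → ∑ (λ x → - f x) xs ≡ - ∑ f xs
∑-neg f []       = refl
∑-neg f (x ∷ xs) = trans (cong (- f x +ℤ_) (∑-neg f xs)) (sym (ℤP.neg-distrib-+ (f x) (∑ f xs)))

∑-*ˡ : {A : Set} (c : ℤ) (f : A → ℤ) (xs : List A) → ∑ (λ x → c *ℤ f x) xs ≡ c *ℤ ∑ f xs
∑-*ˡ c f []       = sym (ℤP.*-zeroʳ c)
∑-*ˡ c f (x ∷ xs) = trans (cong (c *ℤ f x +ℤ_) (∑-*ˡ c f xs)) (sym (ℤP.*-distribˡ-+ c (f x) (∑ f xs)))

∑-*ʳ : {A : Set} (c : ℤ) (f : A → ℤ) (xs : List A) → ∑ (λ x → f x *ℤ c) xs ≡ ∑ f xs *ℤ c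
∑-*ʳ c f xs = begin
  ∑ (λ x → f x *ℤ c) xs  ≡⟨ ∑-cong xs (λ x _ → ℤP.*-comm (f x) c) ⟩
  ∑ (λ x → c *ℤ f x) xs  ≡⟨ ∑-*ˡ c f xs ⟩
  c *ℤ ∑ f xs            ≡⟨ ℤP.*-comm c (∑ f xs) ⟩
  ∑ f xs *ℤ c            ∎
  where open ≡-Reasoning

∑-swap : {A B : Set} (f : A → B → ℤ) (xs : List A) (ys : List B) →
         ∑ (λ x → ∑ (f x) ys) xs ≡ ∑ (λ y → ∑ (λ x → f x y) xs) ys
∑-swap f xs []       = ∑-zero xs
∑-swap f xs (y ∷ ys) = trans (∑-+ (λ x → f x y) (λ x → ∑ (f x) ys) xs)
                             (cong (∑ (λ x → f x y) xs +ℤ_) (∑-swap f xs ys))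

∑-map : {A B : Set} (f : B → ℤ) (g : A → B) (xs : List A) → ∑ f (map g xs) ≡ ∑ (λ x → f (g x)) xs
∑-map f g []       = refl
∑-map f g (x ∷ xs) = cong (f (g x) +ℤ_) (∑-map f g xs)

∑-split : {A : Set} {P : A → Set} (P? : Decidable P) (f : A → ℤ) (xs : List A) →
          ∑ f xs ≡ ∑ f (filter P? xs) +ℤ ∑ f (filter (λ x → ¬? (P? x)) xs)
∑-split P? f [] = refl
∑-split P? f (x ∷ xs) with P? x
... | yes _ = trans (cong (f x +ℤ_) (∑-split P? f xs)) (sym (ℤP.+-assoc (f x) _ _))
... | no  _ = trans (cong (f x +ℤ_) (∑-split P? f xs)) (+ℤ-left-comm (f x) (∑ f (filter P? xs)) _)

𝟙 : {P : Set} → Dec P → ℤ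
𝟙 (yes _) = + 1
𝟙 (no _)  = + 0

𝟙-cong : {P Q : Set} → (P ⇔ Q) → (P? : Dec P) (Q? : Dec Q) → 𝟙 P? ≡ 𝟙 Q?
𝟙-cong P⇔Q (yes _) (yes _) = refl
𝟙-cong P⇔Q (yes p) (no ¬q) = ⊥-elim (¬q (Equivalence.to P⇔Q p))
𝟙-cong P⇔Q (no ¬p) (yes q) = ⊥-elim (¬p (Equivalence.from P⇔Q q))
𝟙-cong P⇔Q (no _)  (no _)  = refl

𝟙-× : {P Q : Set} (P? : Dec P) (Q? : Dec Q) → 𝟙 P? *ℤ 𝟙 Q? ≡ 𝟙 (P? ×-dec Q?)
𝟙-× (yes _) (yes _) = refl
𝟙-× (yes _) (no _)  = refl
𝟙-× (no _)  (yes _) = refl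
𝟙-× (no _)  (no _)  = refl

∑-filter : {A : Set} {P : A → Set} (P? : Decidable P) (f : A → ℤ) (xs : List A) →
           ∑ f (filter P? xs) ≡ ∑ (λ x → f x *ℤ 𝟙 (P? x)) xs
∑-filter P? f [] = refl
∑-filter P? f (x ∷ xs) with P? x
... | yes _ = cong₂ _+ℤ_ (sym (ℤP.*-identityʳ (f x))) (∑-filter P? f xs)
... | no  _ = trans (∑-filter P? f xs)
                    (sym (trans (cong (_+ℤ _) (ℤP.*-zeroʳ (f x))) (ℤP.+-identityˡ _)))

∑-𝟙 : {A : Set} {P : A → Set} (P? : Decidable P) (xs : List A) →
      ∑ (λ x → 𝟙 (P? x)) xs ≡ + length (filter P? xs)
∑-𝟙 P? [] = refl
∑-𝟙 P? (x ∷ xs) with P? x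
... | yes _ = cong (+ 1 +ℤ_) (∑-𝟙 P? xs)
... | no  _ = trans (ℤP.+-identityˡ _) (∑-𝟙 P? xs)

∑-factor : {A B C : Set} (f : A → C → ℤ) (g : B → C → ℤ) (xs : List A) (ys : List B) (zs : List C) →
           ∑ (λ x → ∑ (λ y → ∑ (λ z → f x z *ℤ g y z) zs) ys) xs
             ≡ ∑ (λ z → ∑ (λ x → f x z) xs *ℤ ∑ (λ y → g y z) ys) zs
∑-factor {C = C} f g xs ys zs = begin
  ∑ (λ x → ∑ (λ y → ∑ (λ z → f x z *ℤ g y z) zs) ys) xs
    ≡⟨ ∑-cong xs (λ x _ → ∑-swap (λ y z → f x z *ℤ g y z) ys zs) ⟩
  ∑ (λ x → ∑ (λ z → ∑ (λ y → f x z *ℤ g y z) ys) zs) xs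
    ≡⟨ ∑-cong xs (λ x _ → ∑-cong zs (λ z _ → ∑-*ˡ (f x z) (λ y → g y z) ys)) ⟩
  ∑ (λ x → ∑ (λ z → f x z *ℤ G z) zs) xs
    ≡⟨ ∑-swap (λ x z → f x z *ℤ G z) xs zs ⟩
  ∑ (λ z → ∑ (λ x → f x z *ℤ G z) xs) zs
    ≡⟨ ∑-cong zs (λ z _ → ∑-*ʳ (G z) (λ x → f x z) xs) ⟩
  ∑ (λ z → ∑ (λ x → f x z) xs *ℤ G z) zs
    ∎
  where
  open ≡-Reasoning
  G : C → ℤ
  G z = ∑ (λ y → g y z) ys

∈-divisors⁺ : ∀ {d n} .{{_ : NonZero n}} → d ∣ n → d ∈ divisors n
∈-divisors⁺ {zero}  {n} 0∣n = contradiction (0∣⇒≡0 0∣n) (ℕ.≢-nonZero⁻¹ n)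
∈-divisors⁺ {suc d} {n} d∣n = ∈-filter⁺ (_∣? n) (∈-applyUpTo⁺ suc (∣⇒≤ d∣n)) d∣n

∈-divisors⁻ : ∀ {d n} → d ∈ divisors n → d ∣ n
∈-divisors⁻ {n = n} d∈ = proj₂ (∈-filter⁻ (_∣? n) {xs = applyUpTo suc n} d∈)

divisors-unique : ∀ n → Unique (divisors n)
divisors-unique n = Unique.filter⁺ (_∣? n)
  (Unique.applyUpTo⁺₁ suc n (λ i<j _ eq → ℕP.<⇒≢ i<j (ℕP.suc-injective eq)))

divisor-nonZero : ∀ {d n} .{{_ : NonZero n}} → d ∣ n → NonZero d
divisor-nonZero {zero}  {n} 0∣n = contradiction (0∣⇒≡0 0∣n) (ℕ.≢-nonZero⁻¹ n)
divisor-nonZero {suc d}     _   = _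

div'-cofactor : ∀ {n d} r .{{_ : NonZero n}} → n ≡ r * d → n div' d ≡ r
div'-cofactor {n} {zero}  r n≡r*0 = contradiction (trans n≡r*0 (ℕP.*-zeroʳ r)) (ℕ.≢-nonZero⁻¹ n)
div'-cofactor {n} {suc d} r n≡r*d = trans (cong (_/ suc d) n≡r*d) (m*n/n≡m r (suc d))

cofactor≡1 : ∀ {p a m} .{{_ : NonZero a}} → 1 ≤ p → p * a ≡ m → m ∣ a → p ≡ 1
cofactor≡1 {p} {a} {m} p≥1 p*a≡m m∣a =
  ℕP.*-cancelʳ-≡ p 1 a (trans p*a≡m (trans (sym a≡m) (sym (ℕP.*-identityˡ a))))
  where
  a≡m : a ≡ m
  a≡m = ℕP.≤-antisym (subst (a ≤_) p*a≡m (ℕP.m≤n*m a p {{ℕ.>-nonZero p≥1}})) (∣⇒≤ m∣a)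

div'-* : ∀ {m n d₁ d₂} .{{_ : NonZero m}} .{{_ : NonZero n}} → d₁ ∣ m → d₂ ∣ n →
         (m * n) div' (d₁ * d₂) ≡ (m div' d₁) * (n div' d₂)
div'-* {m} {n} {d₁} {d₂} (divides r₁ m≡r₁d₁) (divides r₂ n≡r₂d₂) = begin
  (m * n) div' (d₁ * d₂)       ≡⟨ div'-cofactor (r₁ * r₂) {{ℕP.m*n≢0 m n}} mn≡ ⟩
  r₁ * r₂                      ≡⟨ cong₂ _*_ (div'-cofactor r₁ m≡r₁d₁) (div'-cofactor r₂ n≡r₂d₂) ⟨
  (m div' d₁) * (n div' d₂)    ∎
  where
  open ≡-Reasoning
  mn≡ : m * n ≡ (r₁ * r₂) * (d₁ * d₂)
  mn≡ = trans (cong₂ _*_ m≡r₁d₁ n≡r₂d₂) (*-interchange r₁ d₁ r₂ d₂)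

div'-∣ : ∀ {d n} .{{_ : NonZero n}} → d ∣ n → n div' d ∣ n
div'-∣ {d} {n} (divides r n≡r*d) = subst (_∣ n) (sym (div'-cofactor r n≡r*d)) (divides d (trans n≡r*d (ℕP.*-comm r d)))

div'-nonZero : ∀ {d n} .{{_ : NonZero n}} → d ∣ n → NonZero (n div' d)
div'-nonZero {d} {n} (divides r n≡r*d) = subst NonZero (sym (div'-cofactor r n≡r*d)) (quotient≢0 (divides r n≡r*d))

divisors-of-divisor : ∀ {e n} .{{_ : NonZero e}} .{{_ : NonZero n}} → e ∣ n →
                      filter (_∣? e) (divisors n) ↭ divisors e
divisors-of-divisor {e} {n} e∣n = same-members⇒↭
  (Unique.filter⁺ (_∣? e) (divisors-unique n)) (divisors-unique e)
  (λ d → mk⇔ (λ d∈ → ∈-divisors⁺ (proj₂ (∈-filter⁻ (_∣? e) {xs = divisors n} d∈)))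
             (λ d∈ → ∈-filter⁺ (_∣? e) (∈-divisors⁺ (∣-trans (∈-divisors⁻ d∈) e∣n)) (∈-divisors⁻ d∈)))

prime-divisor : ∀ n → 2 ≤ n → ∃ λ p → Prime p × p ∣ n
prime-divisor zero          ()
prime-divisor (suc zero)    (s≤s ())
prime-divisor n@(suc (suc _)) _ =
  first (PrimeFactorisation.factors f) (PrimeFactorisation.isFactorisation f) (PrimeFactorisation.factorsPrime f)
  where
  f = factorise n
  first : (ps : List ℕ) → n ≡ product ps → All Prime ps → ∃ λ p → Prime p × p ∣ n
  first []       ()
  first (p ∷ ps) n≡∏ (pr ∷ _) = p , pr , divides (product ps) (trans n≡∏ (ℕP.*-comm p (product ps)))

prime∤⇒coprime : ∀ {p c} → Prime p → ¬ p ∣ c → Coprime c p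
prime∤⇒coprime pr p∤c (i∣c , i∣p) with prime⇒irreducible pr i∣p
... | inj₁ i≡1 = i≡1
... | inj₂ refl = ⊥-elim (p∤c i∣c)

∈-squarefreeCheck⁺ : ∀ {c n} .{{_ : NonZero n}} → 2 ≤ c → c * c ∣ n → c ∈ squarefreeCheck n
∈-squarefreeCheck⁺ {c@(suc (suc i))} {n} (s≤s (s≤s z≤n)) c²∣n =
  ∈-filter⁺ (λ d → d * d ∣? n) (∈-applyUpTo⁺ (λ i → suc (suc i)) i<n) c²∣n
  where
  i<n : i < n
  i<n = ℕP.≤-trans (ℕP.≤-trans (ℕP.n≤1+n (suc i)) (ℕP.m≤m*n c c)) (∣⇒≤ c²∣n)

∈-squarefreeCheck⁻ : ∀ {c n} → c ∈ squarefreeCheck n → 2 ≤ c × c * c ∣ n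
∈-squarefreeCheck⁻ {c} {n} c∈ with ∈-filter⁻ (λ d → d * d ∣? n) {xs = applyUpTo (λ i → suc (suc i)) n} c∈
... | c∈range , c²∣n with ∈-applyUpTo⁻ (λ i → suc (suc i)) c∈range
... | i , _ , refl = s≤s (s≤s z≤n) , c²∣n

SquareFree : ℕ → Set
SquareFree n = ∀ c → 2 ≤ c → ¬ c * c ∣ n

μ-non-squarefree : ∀ {c n} .{{_ : NonZero n}} → 2 ≤ c → c * c ∣ n → μ n ≡ + 0
μ-non-squarefree {c} {n} 2≤c c²∣n with squarefreeCheck n in eq
... | []    = case subst (c ∈_) eq (∈-squarefreeCheck⁺ 2≤c c²∣n) of λ ()
... | _ ∷ _ = refl

μ-squarefree : ∀ {n} → SquareFree n → μ n ≡ signPow (length (primeFactors n))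
μ-squarefree {n} sf with squarefreeCheck n in eq
... | []    = refl
... | c ∷ _ with ∈-squarefreeCheck⁻ {n = n} (subst (c ∈_) (sym eq) (here refl))
...   | 2≤c , c²∣n = ⊥-elim (sf c 2≤c c²∣n)

∈-primeFactors⁺ : ∀ {q n} .{{_ : NonZero n}} → Prime q → q ∣ n → q ∈ primeFactors n
∈-primeFactors⁺ pr q∣n = ∈-filter⁺ prime? (∈-divisors⁺ q∣n) pr

∈-primeFactors⁻ : ∀ {q n} → q ∈ primeFactors n → Prime q × q ∣ n
∈-primeFactors⁻ {n = n} q∈ with ∈-filter⁻ prime? {xs = divisors n} q∈
... | q∈divisors , pr = pr , ∈-divisors⁻ q∈divisors

primeFactors-unique : ∀ n → Unique (primeFactors n)
primeFactors-unique n = Unique.filter⁺ prime? (divisors-unique n)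

primeFactors-prime-mul : ∀ {p d} .{{_ : NonZero d}} → Prime p → ¬ p ∣ d →
                         length (primeFactors (p * d)) ≡ suc (length (primeFactors d))
primeFactors-prime-mul {p} {d} pr p∤d =
  ↭-length (same-members⇒↭ (primeFactors-unique (p * d)) p∷pf-unique same)
  where
  instance
    p≢0 : NonZero p
    p≢0 = prime⇒nonZero pr
    pd≢0 : NonZero (p * d)
    pd≢0 = ℕP.m*n≢0 p d
  p∷pf-unique : Unique (p ∷ primeFactors d)
  p∷pf-unique = All.tabulate (λ q∈ p≡q → p∤d (subst (_∣ d) (sym p≡q) (proj₂ (∈-primeFactors⁻ {n = d} q∈))))
              ∷ primeFactors-unique d
  to : ∀ {q} → q ∈ primeFactors (p * d) → q ∈ p ∷ primeFactors d
  to q∈ with ∈-primeFactors⁻ q∈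
  ... | prq , q∣pd with euclidsLemma p d prq q∣pd
  ... | inj₂ q∣d = there (∈-primeFactors⁺ prq q∣d)
  ... | inj₁ q∣p with prime⇒irreducible pr q∣p
  ...   | inj₁ refl = ⊥-elim (¬prime[1] prq)
  ...   | inj₂ refl = here refl
  from : ∀ {q} → q ∈ p ∷ primeFactors d → q ∈ primeFactors (p * d)
  from (here refl) = ∈-primeFactors⁺ pr (∣m⇒∣m*n d ∣-refl)
  from (there q∈) with ∈-primeFactors⁻ {n = d} q∈
  ... | prq , q∣d = ∈-primeFactors⁺ prq (∣n⇒∣m*n p q∣d)
  same : ∀ q → (q ∈ primeFactors (p * d)) ⇔ (q ∈ p ∷ primeFactors d)
  same q = mk⇔ to from

-- Multiplying a squarefree d by a prime p ∤ d keeps it squarefree: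
-- c² ∣ p·d with p ∤ c² forces c² ∣ d, while p ∣ c would give p² ∣ p·d, i.e. p ∣ d.
squarefree-prime-mul : ∀ {p d} → Prime p → ¬ p ∣ d → SquareFree d → SquareFree (p * d)
squarefree-prime-mul {p} {d} pr p∤d sf c 2≤c c²∣pd =
  sf c 2≤c (coprime-divisor (prime∤⇒coprime pr p∤c²) c²∣pd)
  where
  p∤c : ¬ p ∣ c
  p∤c p∣c = p∤d (*-cancelˡ-∣ p {{prime⇒nonZero pr}} (∣-trans (*-pres-∣ p∣c p∣c) c²∣pd))
  p∤c² : ¬ p ∣ c * c
  p∤c² p∣c² with euclidsLemma c c pr p∣c²
  ... | inj₁ p∣c = p∤c p∣c
  ... | inj₂ p∣c = p∤c p∣c

μ-prime-mul : ∀ {p d} .{{_ : NonZero d}} → Prime p → ¬ p ∣ d → μ (p * d) ≡ - μ d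
μ-prime-mul {p} {d} pr p∤d with squarefreeCheck d in eq
... | [] = begin
  μ (p * d)                                 ≡⟨ μ-squarefree (squarefree-prime-mul pr p∤d d-squarefree) ⟩
  signPow (length (primeFactors (p * d)))   ≡⟨ cong signPow (primeFactors-prime-mul pr p∤d) ⟩
  - signPow (length (primeFactors d))       ∎
  where
  open ≡-Reasoning
  d-squarefree : SquareFree d
  d-squarefree c 2≤c c²∣d = case subst (c ∈_) eq (∈-squarefreeCheck⁺ 2≤c c²∣d) of λ ()
... | c ∷ _ with ∈-squarefreeCheck⁻ {n = d} (subst (c ∈_) (sym eq) (here refl))
...   | 2≤c , c²∣d = μ-non-squarefree {{ℕP.m*n≢0 p d {{prime⇒nonZero pr}}}} 2≤c (∣n⇒∣m*n p c²∣d)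

divisors-exactly-by-p : ∀ {p n} .{{_ : NonZero n}} → Prime p → p ∣ n →
  filter (λ x → ¬? (p * p ∣? x)) (filter (p ∣?_) (divisors n))
    ↭ map (p *_) (filter (λ x → ¬? (p ∣? x)) (divisors n))
divisors-exactly-by-p {p} {n} pr p∣n = same-members⇒↭
  (Unique.filter⁺ _ (Unique.filter⁺ _ (divisors-unique n)))
  (Unique.map⁺ (λ {x} {y} → ℕP.*-cancelˡ-≡ x y p {{prime⇒nonZero pr}})
               (Unique.filter⁺ _ (divisors-unique n)))
  (λ z → mk⇔ to from)
  where
  instance
    p≢0 : NonZero p
    p≢0 = prime⇒nonZero pr
  to : ∀ {z} → z ∈ filter (λ x → ¬? (p * p ∣? x)) (filter (p ∣?_) (divisors n)) →
       z ∈ map (p *_) (filter (λ x → ¬? (p ∣? x)) (divisors n))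
  to z∈ with ∈-filter⁻ (λ x → ¬? (p * p ∣? x)) {xs = filter (p ∣?_) (divisors n)} z∈
  ... | z∈B , p²∤z with ∈-filter⁻ (p ∣?_) {xs = divisors n} z∈B
  ... | z∈D , divides t refl = subst (_∈ map (p *_) (filter (λ x → ¬? (p ∣? x)) (divisors n))) (ℕP.*-comm p t) (∈-map⁺ (p *_) t∈A)
    where
    p∤t : ¬ p ∣ t
    p∤t (divides s refl) = p²∤z (divides s (ℕP.*-assoc s p p))
    t∈A : t ∈ filter (λ x → ¬? (p ∣? x)) (divisors n)
    t∈A = ∈-filter⁺ (λ x → ¬? (p ∣? x)) (∈-divisors⁺ (∣-trans (∣m⇒∣m*n p ∣-refl) (∈-divisors⁻ z∈D))) p∤t
  from : ∀ {z} → z ∈ map (p *_) (filter (λ x → ¬? (p ∣? x)) (divisors n)) →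
         z ∈ filter (λ x → ¬? (p * p ∣? x)) (filter (p ∣?_) (divisors n))
  from z∈ with ∈-map⁻ (p *_) z∈
  ... | d , d∈A , refl with ∈-filter⁻ (λ x → ¬? (p ∣? x)) {xs = divisors n} d∈A
  ... | d∈D , p∤d = ∈-filter⁺ (λ x → ¬? (p * p ∣? x))
                      (∈-filter⁺ (p ∣?_) (∈-divisors⁺ pd∣n) (∣m⇒∣m*n d ∣-refl))
                      (λ p²∣pd → p∤d (*-cancelˡ-∣ p p²∣pd))
    where
    -- n = u·d with p ∣ u·d and p ∤ d, so p ∣ u and hence p·d ∣ n.
    pd∣n : p * d ∣ n
    pd∣n with ∈-divisors⁻ d∈D
    ... | divides u n≡ud with euclidsLemma u d pr (subst (p ∣_) n≡ud p∣n)
    ...   | inj₂ p∣d = ⊥-elim (p∤d p∣d)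
    ...   | inj₁ (divides s refl) = divides s (trans n≡ud (ℕP.*-assoc s p d))

-- For n ≥ 2 pick a prime p ∣ n and
-- split the divisors into those prime to p (sum S), those divisible by p² (μ = 0)
-- and the rest, which are p·d for the former and so contribute −S.
∑μ-divisors : ∀ n .{{_ : NonZero n}} → ∑ μ (divisors n) ≡ 𝟙 (n ℕ.≟ 1)
∑μ-divisors 1 = refl
∑μ-divisors n@(suc (suc _)) with prime-divisor n (s≤s (s≤s z≤n))
... | p , pr , p∣n = begin
  ∑ μ D                              ≡⟨ ∑-split (p ∣?_) μ D ⟩
  ∑ μ B +ℤ ∑ μ A                     ≡⟨ cong (_+ℤ ∑ μ A) (∑-split (p * p ∣?_) μ B) ⟩
  (∑ μ B₁ +ℤ ∑ μ B₂) +ℤ ∑ μ A        ≡⟨ cong (λ s → (s +ℤ ∑ μ B₂) +ℤ ∑ μ A) ∑μ-B₁ ⟩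
  (+ 0 +ℤ ∑ μ B₂) +ℤ ∑ μ A           ≡⟨ cong (λ s → (+ 0 +ℤ s) +ℤ ∑ μ A) ∑μ-B₂ ⟩
  (+ 0 +ℤ - ∑ μ A) +ℤ ∑ μ A          ≡⟨ cong (_+ℤ ∑ μ A) (ℤP.+-identityˡ (- ∑ μ A)) ⟩
  - ∑ μ A +ℤ ∑ μ A                   ≡⟨ ℤP.+-inverseˡ (∑ μ A) ⟩
  + 0                                ∎
  where
  open ≡-Reasoning
  instance
    p≢0 : NonZero p
    p≢0 = prime⇒nonZero pr
  D  = divisors n
  A  = filter (λ x → ¬? (p ∣? x)) D
  B  = filter (p ∣?_) D
  B₁ = filter (p * p ∣?_) B
  B₂ = filter (λ x → ¬? (p * p ∣? x)) B
  ∑μ-B₁ : ∑ μ B₁ ≡ + 0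
  ∑μ-B₁ = trans (∑-cong B₁ μ≡0) (∑-zero B₁)
    where
    μ≡0 : ∀ x → x ∈ B₁ → μ x ≡ + 0
    μ≡0 x x∈ with ∈-filter⁻ (p * p ∣?_) {xs = B} x∈
    ... | x∈B , p²∣x = μ-non-squarefree {{divisor-nonZero x∣n}} (ℕ.nonTrivial⇒n>1 p {{prime⇒nonTrivial pr}}) p²∣x
      where
      x∣n : x ∣ n
      x∣n = ∈-divisors⁻ (proj₁ (∈-filter⁻ (p ∣?_) {xs = D} x∈B))
  ∑μ-B₂ : ∑ μ B₂ ≡ - ∑ μ A
  ∑μ-B₂ = begin
    ∑ μ B₂                   ≡⟨ ∑-↭ μ (divisors-exactly-by-p pr p∣n) ⟩
    ∑ μ (map (p *_) A)       ≡⟨ ∑-map μ (p *_) A ⟩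
    ∑ (λ x → μ (p * x)) A    ≡⟨ ∑-cong A μ-px ⟩
    ∑ (λ x → - μ x) A        ≡⟨ ∑-neg μ A ⟩
    - ∑ μ A                  ∎
    where
    μ-px : ∀ x → x ∈ A → μ (p * x) ≡ - μ x
    μ-px x x∈ with ∈-filter⁻ (λ x → ¬? (p ∣? x)) {xs = D} x∈
    ... | x∈D , p∤x = μ-prime-mul {{divisor-nonZero (∈-divisors⁻ x∈D)}} pr p∤x

Periodic : {X : Set} → ℕ → (ℕ → X) → Set
Periodic a g = ∀ i → g (i + a) ≡ g i

module _ {X : Set} {g : ℕ → X} where

  periodic-*ˡ : ∀ {a} → Periodic a g → ∀ t i → g (i + t * a) ≡ g i
  periodic-*ˡ {a} per zero    i = cong g (ℕP.+-identityʳ i)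
  periodic-*ˡ {a} per (suc t) i = begin
    g (i + (a + t * a))  ≡⟨ cong g (trans (cong (λ t → i + t) (ℕP.+-comm a (t * a))) (sym (ℕP.+-assoc i (t * a) a))) ⟩
    g (i + t * a + a)    ≡⟨ per (i + t * a) ⟩
    g (i + t * a)        ≡⟨ periodic-*ˡ per t i ⟩
    g i                  ∎
    where open ≡-Reasoning

  periodic-∣ : ∀ {a b} → Periodic a g → a ∣ b → Periodic b g
  periodic-∣ per (divides t refl) i = periodic-*ˡ per t i

  periodic-bézout : ∀ {a b c} x y → Periodic a g → Periodic b g → c + y * b ≡ x * a → Periodic c g
  periodic-bézout {a} {b} {c} x y per-a per-b c+yb≡xa i = begin
    g (i + c)              ≡⟨ periodic-*ˡ per-b y (i + c) ⟨
    g (i + c + y * b)      ≡⟨ cong g (trans (ℕP.+-assoc i c (y * b)) (cong (λ t → i + t) c+yb≡xa)) ⟩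
    g (i + x * a)          ≡⟨ periodic-*ˡ per-a x i ⟩
    g i                    ∎
    where open ≡-Reasoning

  periodic-gcd : ∀ {a b} → Periodic a g → Periodic b g → Periodic (gcd a b) g
  periodic-gcd {a} {b} per-a per-b with Bézout.identity (gcd-GCD a b)
  ... | Bézout.+- x y g+yb≡xa = periodic-bézout x y per-a per-b g+yb≡xa
  ... | Bézout.-+ x y g+xa≡yb = periodic-bézout y x per-b per-a g+xa≡yb

  periodic-% : ∀ {a} .{{_ : NonZero a}} → Periodic a g → ∀ i → g i ≡ g (i % a)
  periodic-% {a} per i = trans (cong g (m≡m%n+[m/n]*n i a)) (periodic-*ˡ per (i / a) (i % a))

  periodic-from-residues : ∀ {m a} .{{_ : NonZero m}} → Periodic m g →
                           (∀ {i} → i < m → g (i + a) ≡ g i) → Periodic a g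
  periodic-from-residues {m} {a} per-m residues x = begin
    g (x + a)                   ≡⟨ cong (λ t → g (t + a)) (m≡m%n+[m/n]*n x m) ⟩
    g (x % m + x / m * m + a)   ≡⟨ cong g (+-right-comm (x % m) (x / m * m) a) ⟩
    g (x % m + a + x / m * m)   ≡⟨ periodic-*ˡ per-m (x / m) (x % m + a) ⟩
    g (x % m + a)               ≡⟨ residues (m%n<n x m) ⟩
    g (x % m)                   ≡⟨ periodic-% per-m x ⟨
    g x                         ∎
    where open ≡-Reasoning

quotient≡1⇒≡ : ∀ {d m} (d∣m : d ∣ m) → quotient d∣m ≡ 1 → d ≡ m
quotient≡1⇒≡ {d} d∣m q≡1 = sym (trans (m∣n⇒n≡quotient*m d∣m) (trans (cong (_* d) q≡1) (ℕP.*-identityˡ d)))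

-- If e·a = r·d, then a ∣ r implies d ∣ e (cancel a from e·a = s·a·d).
∣-cross : ∀ {a d e r} .{{_ : NonZero a}} → e * a ≡ r * d → a ∣ r → d ∣ e
∣-cross {a} {d} {e} e*a≡r*d (divides s refl) =
  divides s (ℕP.*-cancelʳ-≡ e (s * d) a (trans e*a≡r*d (*-right-comm s a d)))

search-least : (Q : ℕ → Set) → (∀ a → Dec (Q a)) → ∀ N →
               (∀ b → b < N → ¬ Q b) ⊎ (∃ λ a → Q a × (∀ b → b < a → ¬ Q b))
search-least Q Q? zero = inj₁ (λ b ())
search-least Q Q? (suc N) with search-least Q Q? N
... | inj₂ least = inj₂ least
... | inj₁ none-below with Q? N
...   | yes qN = inj₂ (N , qN , none-below)
...   | no ¬qN = inj₁ none-below-suc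
  where
  none-below-suc : ∀ b → b < suc N → ¬ Q b
  none-below-suc b b<1+N with ℕP.m<1+n⇒m<n∨m≡n b<1+N
  ... | inj₁ b<N  = none-below b b<N
  ... | inj₂ refl = ¬qN

record GeneratingPeriod (P : ℕ → Set) : Set where
  field
    a₀        : ℕ
    a₀≥1      : 1 ≤ a₀
    P-a₀      : P a₀
    a₀-divides : ∀ b → 1 ≤ b → P b → a₀ ∣ b

-- A decidable set P of "periods" that contains m > 0 and is closed under gcd and
-- multiples is generated by its least positive element a₀, and Möbius inversion
-- over the divisors of m detects whether a₀ = m.
module MinimalPeriod (P : ℕ → Set) (P? : ∀ a → Dec (P a))
  (m : ℕ) .{{_ : NonZero m}} (P-m : P m)
  (P-gcd : ∀ {a b} → P a → P b → P (gcd a b))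
  (P-∣ : ∀ {a b} → P a → a ∣ b → P b) where

  generator : GeneratingPeriod P
  generator with search-least (λ a → 1 ≤ a × P a) (λ a → (1 ℕ.≤? a) ×-dec P? a) (suc m)
  ... | inj₁ none = ⊥-elim (none m (ℕP.n<1+n m) (ℕ.>-nonZero⁻¹ m , P-m))
  ... | inj₂ (a₀ , (a₀≥1 , P-a₀) , minimal) = record
    { a₀ = a₀ ; a₀≥1 = a₀≥1 ; P-a₀ = P-a₀ ; a₀-divides = a₀-divides }
    where
    -- gcd(a₀, b) is a positive period ≤ a₀, hence equal to a₀ by minimality.
    a₀-divides : ∀ b → 1 ≤ b → P b → a₀ ∣ b
    a₀-divides b _ P-b = subst (_∣ b) gcd≡a₀ (gcd[m,n]∣n a₀ b)
      where
      instance
        a₀≢0 : NonZero a₀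
        a₀≢0 = ℕ.>-nonZero a₀≥1
      gcd≥1 : 1 ≤ gcd a₀ b
      gcd≥1 = ℕ.>-nonZero⁻¹ _ {{ℕ.≢-nonZero (gcd[m,n]≢0 a₀ b (inj₁ (ℕ.≢-nonZero⁻¹ a₀)))}}
      gcd≡a₀ : gcd a₀ b ≡ a₀
      gcd≡a₀ = ℕP.≤∧≮⇒≡ (∣⇒≤ (gcd[m,n]∣m a₀ b)) (λ gcd<a₀ → minimal _ gcd<a₀ (gcd≥1 , P-gcd P-a₀ P-b))

  open GeneratingPeriod generator public

  a₀∣m : a₀ ∣ m
  a₀∣m = a₀-divides m (ℕ.>-nonZero⁻¹ m) P-m

  e : ℕ
  e = quotient a₀∣m

  m≡e*a₀ : m ≡ e * a₀
  m≡e*a₀ = m∣n⇒n≡quotient*m a₀∣m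

  instance
    a₀≢0 : NonZero a₀
    a₀≢0 = ℕ.>-nonZero a₀≥1
    e≢0 : NonZero e
    e≢0 = quotient≢0 a₀∣m

  e≡1⇔a₀≡m : (e ≡ 1) ⇔ (a₀ ≡ m)
  e≡1⇔a₀≡m = mk⇔ (quotient≡1⇒≡ a₀∣m)
                 (λ a₀≡m → ℕP.*-cancelʳ-≡ e 1 a₀ (trans (sym m≡e*a₀) (trans (sym a₀≡m) (sym (ℕP.*-identityˡ a₀)))))

  cofactor-period⇔ : ∀ {d} → d ∈ divisors m → P (m div' d) ⇔ (d ∣ e)
  cofactor-period⇔ {d} d∈ with ∈-divisors⁻ d∈
  ... | divides r m≡r*d = subst (λ x → P x ⇔ (d ∣ e)) (sym (div'-cofactor r m≡r*d))
    (mk⇔ (λ P-r → ∣-cross e*a₀≡r*d (a₀-divides r r≥1 P-r))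
         (λ d∣e → P-∣ P-a₀ (∣-cross {{divisor-nonZero (∈-divisors⁻ d∈)}} (sym e*a₀≡r*d) d∣e)))
    where
    e*a₀≡r*d : e * a₀ ≡ r * d
    e*a₀≡r*d = trans (sym m≡e*a₀) m≡r*d
    r≥1 : 1 ≤ r
    r≥1 = ℕ.>-nonZero⁻¹ r {{quotient≢0 (divides r m≡r*d)}}

  ∑μ-periods : ∑ (λ d → μ d *ℤ 𝟙 (P? (m div' d))) (divisors m) ≡ 𝟙 (a₀ ℕ.≟ m)
  ∑μ-periods = begin
    ∑ (λ d → μ d *ℤ 𝟙 (P? (m div' d))) (divisors m)
      ≡⟨ ∑-cong (divisors m) (λ d d∈ → cong (μ d *ℤ_) (𝟙-cong (cofactor-period⇔ d∈) (P? _) (d ∣? e))) ⟩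
    ∑ (λ d → μ d *ℤ 𝟙 (d ∣? e)) (divisors m)    ≡⟨ ∑-filter (_∣? e) μ (divisors m) ⟨
    ∑ μ (filter (_∣? e) (divisors m))            ≡⟨ ∑-↭ μ (divisors-of-divisor (divides a₀ (trans m≡e*a₀ (ℕP.*-comm e a₀)))) ⟩
    ∑ μ (divisors e)                             ≡⟨ ∑μ-divisors e ⟩
    𝟙 (e ℕ.≟ 1)                                  ≡⟨ 𝟙-cong e≡1⇔a₀≡m (e ℕ.≟ 1) (a₀ ℕ.≟ m) ⟩
    𝟙 (a₀ ℕ.≟ m)                                 ∎
    where open ≡-Reasoning

vectors : {A : Set} → List A → (n : ℕ) → List (Vec A n)
vectors xs zero    = Vec.[] ∷ []
vectors xs (suc n) = cartesianProductWith Vec._∷_ xs (vectors xs n)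

length-cartesianProductWith : {A B C : Set} (f : A → B → C) (xs : List A) (ys : List B) →
                              length (cartesianProductWith f xs ys) ≡ length xs * length ys
length-cartesianProductWith f []       ys = refl
length-cartesianProductWith f (x ∷ xs) ys =
  trans (length-++ (map (f x) ys)) (cong₂ _+_ (length-map (f x) ys) (length-cartesianProductWith f xs ys))

length-vectors : {A : Set} (xs : List A) (n : ℕ) → length (vectors xs n) ≡ length xs ^ n
length-vectors xs zero    = refl
length-vectors xs (suc n) =
  trans (length-cartesianProductWith Vec._∷_ xs (vectors xs n)) (cong (length xs *_) (length-vectors xs n))

vectors-unique : {A : Set} {xs : List A} → Unique xs → (n : ℕ) → Unique (vectors xs n)
vectors-unique u zero    = [] ∷ []
vectors-unique u (suc n) = Unique.cartesianProductWith⁺ Vec._∷_ VecP.∷-injective u (vectors-unique u n)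

∈-vectors : {A : Set} {xs : List A} → (∀ x → x ∈ xs) → {n : ℕ} (v : Vec A n) → v ∈ vectors xs n
∈-vectors all∈ Vec.[]       = here refl
∈-vectors all∈ (x Vec.∷ v) = ∈-cartesianProductWith⁺ Vec._∷_ (all∈ x) (∈-vectors all∈ v)

arrays : (k m n : ℕ) → List (Array k m n)
arrays k m n = vectors (vectors (allFin k) n) m

length-arrays : ∀ k m n → length (arrays k m n) ≡ k ^ (m * n)
length-arrays k m n = begin
  length (arrays k m n)               ≡⟨ length-vectors _ m ⟩
  length (vectors (allFin k) n) ^ m   ≡⟨ cong (_^ m) (length-vectors (allFin k) n) ⟩
  (length (allFin k) ^ n) ^ m         ≡⟨ cong (λ l → (l ^ n) ^ m) (length-tabulate {n = k} (λ i → i)) ⟩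
  (k ^ n) ^ m                         ≡⟨ ℕP.^-*-assoc k n m ⟩
  k ^ (n * m)                         ≡⟨ cong (k ^_) (ℕP.*-comm n m) ⟩
  k ^ (m * n)                         ∎
  where open ≡-Reasoning

arrays-unique : ∀ k m n → Unique (arrays k m n)
arrays-unique k m n = vectors-unique (vectors-unique (Unique.allFin⁺ k) n) m

∈-arrays : ∀ {k m n} (M : Array k m n) → M ∈ arrays k m n
∈-arrays M = ∈-vectors (∈-vectors ∈-allFin) M

array-ext : ∀ {k m n} {M M′ : Array k m n} → (∀ i j → entry M i j ≡ entry M′ i j) → M ≡ M′
array-ext {M = M} {M′} same = begin
  M                                              ≡⟨ tabulate∘entry M ⟨
  tabulate (λ i → tabulate (λ j → entry M i j))   ≡⟨ VecP.tabulate-cong (λ i → VecP.tabulate-cong (same i)) ⟩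
  tabulate (λ i → tabulate (λ j → entry M′ i j))  ≡⟨ tabulate∘entry M′ ⟩
  M′                                             ∎
  where
  open ≡-Reasoning
  tabulate∘entry : ∀ M → tabulate (λ i → tabulate (λ j → entry M i j)) ≡ M
  tabulate∘entry M = trans (VecP.tabulate-cong (λ i → VecP.tabulate∘lookup (lookup M i))) (VecP.tabulate∘lookup M)

entry-tabulate : ∀ {k m n} (f : Fin m → Fin n → Fin k) i j →
                 entry (tabulate (λ i → tabulate (f i))) i j ≡ f i j
entry-tabulate f i j = trans (cong (λ row → lookup row j) (VecP.lookup∘tabulate _ i)) (VecP.lookup∘tabulate (f i) j)

toℕ-mod : ∀ x {m} .{{_ : NonZero m}} → toℕ (x mod m) ≡ x % m
toℕ-mod x {m} = FinP.toℕ-fromℕ< (m%n<n x m)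

mod-cong : ∀ {x y m} .{{_ : NonZero m}} → x % m ≡ y % m → x mod m ≡ y mod m
mod-cong {x} {y} x≡y = FinP.toℕ-injective (trans (toℕ-mod x) (trans x≡y (sym (toℕ-mod y))))

toℕ-mod-id : ∀ {m} .{{_ : NonZero m}} (i : Fin m) → toℕ i mod m ≡ i
toℕ-mod-id i = FinP.toℕ-injective (trans (toℕ-mod (toℕ i)) (m<n⇒m%n≡m (FinP.toℕ<n i)))

mod-mod : ∀ {a m} .{{_ : NonZero a}} .{{_ : NonZero m}} → a ∣ m → ∀ x → toℕ (x mod m) mod a ≡ x mod a
mod-mod {a} {m} a∣m x = mod-cong (trans (cong (_% a) (toℕ-mod x)) (m∣n⇒o%n%m≡o%m a m x a∣m))

module ArrayPeriods (k m n : ℕ) .{{_ : NonZero m}} .{{_ : NonZero n}} where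

  ext : Array k m n → ℕ → ℕ → Fin k
  ext M x y = entry M (x mod m) (y mod n)

  ext-%ˣ : ∀ M x y → ext M x y ≡ ext M (x % m) y
  ext-%ˣ M x y = cong (λ i → entry M i (y mod n)) (mod-cong (sym (m%n%n≡m%n x m)))

  ext-%ʸ : ∀ M x y → ext M x y ≡ ext M x (y % n)
  ext-%ʸ M x y = cong (entry M (x mod m)) (mod-cong (sym (m%n%n≡m%n y n)))

  ext-toℕ : ∀ M i j → ext M (toℕ i) (toℕ j) ≡ entry M i j
  ext-toℕ M i j = cong₂ (entry M) (toℕ-mod-id i) (toℕ-mod-id j)

  RowPeriod : ℕ → Array k m n → Set
  RowPeriod a M = ∀ y → Periodic a (λ x → ext M x y)

  ColPeriod : ℕ → Array k m n → Set
  ColPeriod b M = ∀ x → Periodic b (λ y → ext M x y)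

  rowPeriod-m : ∀ M → RowPeriod m M
  rowPeriod-m M y x = cong (λ i → entry M i (y mod n)) (mod-cong ([m+n]%n≡m%n x m))

  colPeriod-n : ∀ M → ColPeriod n M
  colPeriod-n M x y = cong (entry M (x mod m)) (mod-cong ([m+n]%n≡m%n y n))

  rowPeriod-gcd : ∀ {M a b} → RowPeriod a M → RowPeriod b M → RowPeriod (gcd a b) M
  rowPeriod-gcd per-a per-b y = periodic-gcd (per-a y) (per-b y)

  colPeriod-gcd : ∀ {M a b} → ColPeriod a M → ColPeriod b M → ColPeriod (gcd a b) M
  colPeriod-gcd per-a per-b x = periodic-gcd (per-a x) (per-b x)

  rowPeriod-∣ : ∀ {M a b} → RowPeriod a M → a ∣ b → RowPeriod b M
  rowPeriod-∣ per a∣b y = periodic-∣ (per y) a∣b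

  colPeriod-∣ : ∀ {M a b} → ColPeriod a M → a ∣ b → ColPeriod b M
  colPeriod-∣ per a∣b x = periodic-∣ (per x) a∣b

  -- Periods are decidable: it suffices to compare the entries of M itself.
  rowPeriod? : ∀ a M → Dec (RowPeriod a M)
  rowPeriod? a M = map′ extend restrict
    (ℕP.allUpTo? (λ y → ℕP.allUpTo? (λ x → ext M (x + a) y Fin.≟ ext M x y) m) n)
    where
    restrict : RowPeriod a M → ∀ {y} → y < n → ∀ {x} → x < m → ext M (x + a) y ≡ ext M x y
    restrict per _ _ = per _ _
    extend : (∀ {y} → y < n → ∀ {x} → x < m → ext M (x + a) y ≡ ext M x y) → RowPeriod a M
    extend checked y x = begin
      ext M (x + a) y        ≡⟨ ext-%ʸ M (x + a) y ⟩
      ext M (x + a) (y % n)  ≡⟨ periodic-from-residues (rowPeriod-m M (y % n)) (checked (m%n<n y n)) x ⟩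
      ext M x (y % n)        ≡⟨ ext-%ʸ M x y ⟨
      ext M x y              ∎
      where open ≡-Reasoning

  colPeriod? : ∀ b M → Dec (ColPeriod b M)
  colPeriod? b M = map′ extend restrict
    (ℕP.allUpTo? (λ x → ℕP.allUpTo? (λ y → ext M x (y + b) Fin.≟ ext M x y) n) m)
    where
    restrict : ColPeriod b M → ∀ {x} → x < m → ∀ {y} → y < n → ext M x (y + b) ≡ ext M x y
    restrict per _ _ = per _ _
    extend : (∀ {x} → x < m → ∀ {y} → y < n → ext M x (y + b) ≡ ext M x y) → ColPeriod b M
    extend checked x y = begin
      ext M x (y + b)        ≡⟨ ext-%ˣ M x (y + b) ⟩
      ext M (x % m) (y + b)  ≡⟨ periodic-from-residues (colPeriod-n M (x % m)) (checked (m%n<n x m)) y ⟩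
      ext M (x % m) y        ≡⟨ ext-%ˣ M x y ⟨
      ext M x y              ∎
      where open ≡-Reasoning

  Periods : ℕ → ℕ → Array k m n → Set
  Periods a b M = RowPeriod a M × ColPeriod b M

  periods? : ∀ a b M → Dec (Periods a b M)
  periods? a b M = rowPeriod? a M ×-dec colPeriod? b M

  module Powers (a b : ℕ) .{{_ : NonZero a}} .{{_ : NonZero b}} where

    Repeats : Array k m n → Array k a b → Set
    Repeats M A = ∀ i j → entry M i j ≡ entry A (toℕ i mod a) (toℕ j mod b)

    power : Array k a b → Array k m n
    power A = tabulate (λ i → tabulate (λ j → entry A (toℕ i mod a) (toℕ j mod b)))

    corner : Array k m n → Array k a b
    corner M = tabulate (λ i → tabulate (λ j → ext M (toℕ i) (toℕ j)))

    power-repeats : ∀ A → Repeats (power A) A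
    power-repeats A = entry-tabulate (λ i j → entry A (toℕ i mod a) (toℕ j mod b))

    repeats⇒≡power : ∀ M A → Repeats M A → M ≡ power A
    repeats⇒≡power M A rep = array-ext (λ i j → trans (rep i j) (sym (power-repeats A i j)))

    module _ (a∣m : a ∣ m) (b∣n : b ∣ n) (M : Array k m n) (A : Array k a b) (rep : Repeats M A) where

      repeats-ext : ∀ x y → ext M x y ≡ entry A (x mod a) (y mod b)
      repeats-ext x y = trans (rep (x mod m) (y mod n)) (cong₂ (entry A) (mod-mod a∣m x) (mod-mod b∣n y))

      repeats⇒periods : Periods a b M
      repeats⇒periods = rows , cols
        where
        rows : RowPeriod a M
        rows y x = trans (repeats-ext (x + a) y)
          (trans (cong (λ i → entry A i (y mod b)) (mod-cong ([m+n]%n≡m%n x a))) (sym (repeats-ext x y)))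
        cols : ColPeriod b M
        cols x y = trans (repeats-ext x (y + b))
          (trans (cong (entry A (x mod a)) (mod-cong ([m+n]%n≡m%n y b))) (sym (repeats-ext x y)))

      corner-repeats : corner M ≡ A
      corner-repeats = array-ext λ i j → begin
        entry (corner M) i j                    ≡⟨ entry-tabulate (λ i j → ext M (toℕ i) (toℕ j)) i j ⟩
        ext M (toℕ i) (toℕ j)                   ≡⟨ repeats-ext (toℕ i) (toℕ j) ⟩
        entry A (toℕ i mod a) (toℕ j mod b)     ≡⟨ cong₂ (entry A) (toℕ-mod-id i) (toℕ-mod-id j) ⟩
        entry A i j                             ∎
        where open ≡-Reasoning

    periods⇒repeats : ∀ M → Periods a b M → Repeats M (corner M)
    periods⇒repeats M (rows , cols) i j = begin
      entry M i j                                       ≡⟨ ext-toℕ M i j ⟨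
      ext M (toℕ i) (toℕ j)                             ≡⟨ periodic-% (rows (toℕ j)) (toℕ i) ⟩
      ext M (toℕ i % a) (toℕ j)                         ≡⟨ periodic-% (cols (toℕ i % a)) (toℕ j) ⟩
      ext M (toℕ i % a) (toℕ j % b)                     ≡⟨ cong₂ (ext M) (toℕ-mod (toℕ i)) (toℕ-mod (toℕ j)) ⟨
      ext M (toℕ (toℕ i mod a)) (toℕ (toℕ j mod b))     ≡⟨ entry-tabulate (λ i j → ext M (toℕ i) (toℕ j)) _ _ ⟨
      entry (corner M) (toℕ i mod a) (toℕ j mod b)      ∎
      where open ≡-Reasoning

    -- For a ∣ m, b ∣ n there are exactly k^(a·b) arrays with periods a and b:
    -- they are the powers of the a × b arrays, and `power` is injective.
    count-periodic : a ∣ m → b ∣ n → length (filter (periods? a b) (arrays k m n)) ≡ k ^ (a * b)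
    count-periodic a∣m b∣n = begin
      length (filter (periods? a b) (arrays k m n))  ≡⟨ ↭-length periodic↭powers ⟩
      length (map power (arrays k a b))              ≡⟨ length-map power (arrays k a b) ⟩
      length (arrays k a b)                          ≡⟨ length-arrays k a b ⟩
      k ^ (a * b)                                    ∎
      where
      open ≡-Reasoning
      power-injective : ∀ {A A′} → power A ≡ power A′ → A ≡ A′
      power-injective {A} {A′} eq = trans (sym (corner-repeats a∣m b∣n (power A) A (power-repeats A)))
        (trans (cong corner eq) (corner-repeats a∣m b∣n (power A′) A′ (power-repeats A′)))
      to : ∀ {M} → M ∈ filter (periods? a b) (arrays k m n) → M ∈ map power (arrays k a b)
      to {M} M∈ with ∈-filter⁻ (periods? a b) {xs = arrays k m n} M∈
      ... | _ , periods = subst (_∈ map power (arrays k a b))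
        (sym (repeats⇒≡power M (corner M) (periods⇒repeats M periods)))
        (∈-map⁺ power (∈-arrays (corner M)))
      from : ∀ {M} → M ∈ map power (arrays k a b) → M ∈ filter (periods? a b) (arrays k m n)
      from M∈ with ∈-map⁻ power M∈
      ... | A , _ , refl = ∈-filter⁺ (periods? a b) (∈-arrays (power A)) (repeats⇒periods a∣m b∣n (power A) A (power-repeats A))
      periodic↭powers : filter (periods? a b) (arrays k m n) ↭ map power (arrays k a b)
      periodic↭powers = same-members⇒↭ (Unique.filter⁺ (periods? a b) (arrays-unique k m n))
        (Unique.map⁺ power-injective (arrays-unique k a b)) (λ M → mk⇔ to from)

module Primitivity (k m n : ℕ) .{{m≢0 : NonZero m}} .{{n≢0 : NonZero n}} where

  open ArrayPeriods k m n

  module Rows (M : Array k m n) =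
    MinimalPeriod (λ a → RowPeriod a M) (λ a → rowPeriod? a M) m (rowPeriod-m M) (rowPeriod-gcd {M}) (rowPeriod-∣ {M})
  module Cols (M : Array k m n) =
    MinimalPeriod (λ b → ColPeriod b M) (λ b → colPeriod? b M) n (colPeriod-n M) (colPeriod-gcd {M}) (colPeriod-∣ {M})

  FullPeriods : Array k m n → Set
  FullPeriods M = Rows.a₀ M ≡ m × Cols.a₀ M ≡ n

  fullPeriods? : ∀ M → Dec (FullPeriods M)
  fullPeriods? M = (Rows.a₀ M ℕ.≟ m) ×-dec (Cols.a₀ M ℕ.≟ n)

  periods⇒isPower : ∀ {a b} .{{_ : NonZero a}} .{{_ : NonZero b}} (a∣m : a ∣ m) (b∣n : b ∣ n) M →
                    Periods a b M → IsPower M (Powers.corner a b M) (quotient a∣m) (quotient b∣n)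
  periods⇒isPower {a} {b} a∣m b∣n M periods =
    sym (m∣n⇒n≡quotient*m a∣m) , sym (m∣n⇒n≡quotient*m b∣n) , Powers.periods⇒repeats a b M periods

  primitive⇒periods-full : ∀ M → Primitive M → ∀ {a b} .{{_ : NonZero a}} .{{_ : NonZero b}} →
                           (a∣m : a ∣ m) (b∣n : b ∣ n) → Periods a b M → a ≡ m × b ≡ n
  primitive⇒periods-full M prim {a} {b} a∣m b∣n periods
    with prim a b (Powers.corner a b M) (quotient a∣m) (quotient b∣n)
              (ℕ.>-nonZero⁻¹ _ {{quotient≢0 a∣m}}) (ℕ.>-nonZero⁻¹ _ {{quotient≢0 b∣n}})
              (periods⇒isPower a∣m b∣n M periods)
  ... | p≡1 , q≡1 = quotient≡1⇒≡ a∣m p≡1 , quotient≡1⇒≡ b∣n q≡1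

  -- Primitivity forces the least periods to be full: M repeats its a₀ × n corner.
  primitive⇒fullPeriods : ∀ M → Primitive M → FullPeriods M
  primitive⇒fullPeriods M prim =
    proj₁ (primitive⇒periods-full M prim {{Rows.a₀≢0 M}} (Rows.a₀∣m M) ∣-refl (Rows.P-a₀ M , colPeriod-n M)) ,
    proj₂ (primitive⇒periods-full M prim {{m≢0}} {{Cols.a₀≢0 M}} ∣-refl (Cols.a₀∣m M) (rowPeriod-m M , Cols.P-a₀ M))

  -- Conversely, if M = A^{p×q} with A of size a × b, then a and b are periods of M,
  -- so m ∣ a and n ∣ b by minimality, which forces p = q = 1.
  fullPeriods⇒primitive : ∀ M → FullPeriods M → Primitive M
  fullPeriods⇒primitive M (rows≡m , cols≡n) a b A p q p≥1 q≥1 (p*a≡m , q*b≡n , rep)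
    with Powers.repeats⇒periods a b (divides p (sym p*a≡m)) (divides q (sym q*b≡n)) M A rep
  ... | rows-a , cols-b =
    cofactor≡1 p≥1 p*a≡m (subst (_∣ a) rows≡m (Rows.a₀-divides M a (ℕ.>-nonZero⁻¹ a) rows-a)) ,
    cofactor≡1 q≥1 q*b≡n (subst (_∣ b) cols≡n (Cols.a₀-divides M b (ℕ.>-nonZero⁻¹ b) cols-b))

  rowTerm : ℕ → Array k m n → ℤ
  rowTerm d M = μ d *ℤ 𝟙 (rowPeriod? (m div' d) M)

  colTerm : ℕ → Array k m n → ℤ
  colTerm d M = μ d *ℤ 𝟙 (colPeriod? (n div' d) M)

  ψ-term : ∀ {d₁ d₂} → d₁ ∈ divisors m → d₂ ∈ divisors n →
           (μ d₁ *ℤ μ d₂) *ℤ + (k ^ ((m * n) div' (d₁ * d₂)))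
             ≡ ∑ (λ M → rowTerm d₁ M *ℤ colTerm d₂ M) (arrays k m n)
  ψ-term {d₁} {d₂} d₁∈ d₂∈ = begin
    μμ *ℤ + (k ^ ((m * n) div' (d₁ * d₂)))                  ≡⟨ cong (λ e → μμ *ℤ + (k ^ e)) (div'-* d₁∣m d₂∣n) ⟩
    μμ *ℤ + (k ^ (r₁ * r₂))                                 ≡⟨ cong (λ c → μμ *ℤ + c) count ⟨
    μμ *ℤ + length (filter (periods? r₁ r₂) (arrays k m n))  ≡⟨ cong (μμ *ℤ_) (∑-𝟙 (periods? r₁ r₂) (arrays k m n)) ⟨
    μμ *ℤ ∑ (λ M → 𝟙 (periods? r₁ r₂ M)) (arrays k m n)     ≡⟨ ∑-*ˡ μμ (λ M → 𝟙 (periods? r₁ r₂ M)) (arrays k m n) ⟨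
    ∑ (λ M → μμ *ℤ 𝟙 (periods? r₁ r₂ M)) (arrays k m n)     ≡⟨ ∑-cong (arrays k m n) (λ M _ → split M) ⟩
    ∑ (λ M → rowTerm d₁ M *ℤ colTerm d₂ M) (arrays k m n)   ∎
    where
    open ≡-Reasoning
    μμ = μ d₁ *ℤ μ d₂
    r₁ = m div' d₁
    r₂ = n div' d₂
    d₁∣m = ∈-divisors⁻ d₁∈
    d₂∣n = ∈-divisors⁻ d₂∈
    count : length (filter (periods? r₁ r₂) (arrays k m n)) ≡ k ^ (r₁ * r₂)
    count = Powers.count-periodic r₁ r₂ {{div'-nonZero d₁∣m}} {{div'-nonZero d₂∣n}} (div'-∣ d₁∣m) (div'-∣ d₂∣n)
    split : ∀ M → μμ *ℤ 𝟙 (periods? r₁ r₂ M) ≡ rowTerm d₁ M *ℤ colTerm d₂ M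
    split M = trans (cong (μμ *ℤ_) (sym (𝟙-× (rowPeriod? r₁ M) (colPeriod? r₂ M))))
                    (*ℤ-interchange (μ d₁) (μ d₂) (𝟙 (rowPeriod? r₁ M)) (𝟙 (colPeriod? r₂ M)))

  ψ-counts : ψ k m n ≡ + length (filter fullPeriods? (arrays k m n))
  ψ-counts = begin
    ψ k m n
      ≡⟨ ∑-cong (divisors m) (λ d₁ d₁∈ → ∑-cong (divisors n) (λ d₂ d₂∈ → ψ-term d₁∈ d₂∈)) ⟩
    ∑ (λ d₁ → ∑ (λ d₂ → ∑ (λ M → rowTerm d₁ M *ℤ colTerm d₂ M) (arrays k m n)) (divisors n)) (divisors m)
      ≡⟨ ∑-factor rowTerm colTerm (divisors m) (divisors n) (arrays k m n) ⟩
    ∑ (λ M → ∑ (λ d → rowTerm d M) (divisors m) *ℤ ∑ (λ d → colTerm d M) (divisors n)) (arrays k m n)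
      ≡⟨ ∑-cong (arrays k m n) (λ M _ → cong₂ _*ℤ_ (Rows.∑μ-periods M) (Cols.∑μ-periods M)) ⟩
    ∑ (λ M → 𝟙 (Rows.a₀ M ℕ.≟ m) *ℤ 𝟙 (Cols.a₀ M ℕ.≟ n)) (arrays k m n)
      ≡⟨ ∑-cong (arrays k m n) (λ M _ → 𝟙-× (Rows.a₀ M ℕ.≟ m) (Cols.a₀ M ℕ.≟ n)) ⟩
    ∑ (λ M → 𝟙 (fullPeriods? M)) (arrays k m n)
      ≡⟨ ∑-𝟙 fullPeriods? (arrays k m n) ⟩
    + length (filter fullPeriods? (arrays k m n))
      ∎
    where open ≡-Reasoning

theorem12 : (k m n : ℕ) → .{{NonZero k}} → .{{NonZero m}} → .{{NonZero n}} →
            NumberOfPrimitiveArrays≡ k m n (ψ k m n)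
theorem12 k m n =
  filter fullPeriods? (arrays k m n) ,
  Unique.filter⁺ fullPeriods? (arrays-unique k m n) ,
  (λ M → mk⇔ (λ M∈ → fullPeriods⇒primitive M (proj₂ (∈-filter⁻ fullPeriods? {xs = arrays k m n} M∈)))
             (λ prim → ∈-filter⁺ fullPeriods? (∈-arrays M) (primitive⇒fullPeriods M prim))) ,
  sym ψ-counts
  where open Primitivity k m n
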